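{- Let $\mathcal F$ be a $1$-dense union-closed family over $[n]$. Then the relation $\subseteq_{\mathcal F}$ is transitive: for $A,B,C\in\mathcal F$, if $A\subseteq_{\mathcal F}B$ and $B\subseteq_{\mathcal F}C$ then $A\subseteq_{\mathcal F}C$.
   Context: A family of subsets of $[n]$ is union-closed over $[n]$ if it contains $[n]$ and is closed under pairwise unions; the empty set is never a member of any family, and $2^{[n]}$ denotes all nonempty subsets of $[n]$. The closure of $\mathcal F$ is $\overline{\mathcal F}=\{A\in 2^{[n]}:\ \mathcal F\cup\{A\}\text{ is union-closed}\}$; $\mathcal F$ is $1$-dense if $\mathcal F\ne 2^{[n]}$ and $\overline{\mathcal F}=2^{[n]}$. Relative subsets: for $A,B\in\mathcal F$, $A\subseteq_{\mathcal F}B$ means that $A=B$, or $B=[n]$, or there exists $C\in\mathcal F$ with $C\neq B$ and $A\cup C=B$. -}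

module Defs where

open import Data.Nat using (ℕ)
open import Data.Fin.Subset using (Subset; ⊤; _∪_; Nonempty)
open import Data.Product using (Σ; _×_; ∃)
open import Data.Sum using (_⊎_)
open import Relation.Binary.PropositionalEquality using (_≡_; _≢_)
open import Relation.Nullary using (¬_)

-- A family of subsets of [n] = Fin n is a predicate on subsets
-- (Subset n = Vec Bool n).  The empty set is never a member.
Family : ℕ → Set₁
Family n = Subset n → Set

insert : ∀ {n} → Family n → Subset n → Family n
insert F A X = F X ⊎ X ≡ A

UnionClosed : ∀ {n} → Family n → Set
UnionClosed {n} F =
  (∀ A → F A → Nonempty A)
  × F ⊤
  × (∀ A B → F A → F B → F (A ∪ B))

InClosure : ∀ {n} → Family n → Subset n → Set
InClosure F A = Nonempty A × UnionClosed (insert F A)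

OneDense : ∀ {n} → Family n → Set
OneDense {n} F =
  (Σ (Subset n) λ A → Nonempty A × ¬ F A)
  × (∀ A → Nonempty A → InClosure F A)

RelSub : ∀ {n} → Family n → Subset n → Subset n → Set
RelSub {n} F A B =
  A ≡ B ⊎ B ≡ ⊤ ⊎ (Σ (Subset n) λ C → F C × C ≢ B × A ∪ C ≡ B)

module Submission where

-- The whole argument rests on one structural fact: a 1-dense family F is
-- an up-set, i.e. every superset of a member is a member.  Given D ∈ F
-- and D ⊆ Y, pick d ∈ D and let W = Y ∖ {d}.  If W is nonempty it lies in
-- the closure of F, so D ∪ W = Y belongs to F ∪ {W}, and Y ≠ W because
-- d ∈ Y; if W is empty then Y = D.
--
-- Every relative subset is an honest subset.  Now let A ⊆_F B ⊆_F C.  If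
-- A = B or B = [n] the claim is immediate (in the latter case C = [n]).
-- Otherwise A ∪ D = B for some D ∈ F with D ≠ B, and since B ⊆ C the set
-- G = D ∪ (C ∖ A) is a member of F by up-closure, satisfies A ∪ G = C,
-- and differs from C (else B ⊆ D, forcing D = B); so G witnesses
-- A ⊆_F C.

open import Defs
open import Data.Nat using (ℕ)
open import Data.Fin using (Fin)
open import Data.Fin.Subset
open import Data.Fin.Subset.Properties
open import Data.Product using (_,_; proj₂)
open import Data.Sum using (inj₁; inj₂; [_,_])
open import Relation.Nullary using (Dec; yes; no; contradiction)
open import Relation.Binary.PropositionalEquality
  using (_≡_; _≢_; refl; sym; subst; module ≡-Reasoning)

module _ {n : ℕ} where

  ∪-least : {P Q R : Subset n} → P ⊆ R → Q ⊆ R → P ∪ Q ⊆ R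
  ∪-least {P} {Q} P⊆R Q⊆R x∈P∪Q = [ P⊆R , Q⊆R ] (x∈p∪q⁻ P Q x∈P∪Q)

  ∪-refill : {P Q R : Subset n} → R ⊆ P → P ⊆ Q → P ∪ (Q ∩ ∁ R) ≡ Q
  ∪-refill {P} {Q} {R} R⊆P P⊆Q =
    ⊆-antisym (∪-least P⊆Q (p∩q⊆p Q (∁ R))) Q⊆P∪Q∖R
    where
    Q⊆P∪Q∖R : Q ⊆ P ∪ (Q ∩ ∁ R)
    Q⊆P∪Q∖R {x} x∈Q with x ∈? R
    ... | yes x∈R = x∈p∪q⁺ (inj₁ (R⊆P x∈R))
    ... | no  x∉R = x∈p∪q⁺ (inj₂ (x∈p∩q⁺ (x∈Q , x∉p⇒x∈∁p x∉R)))

  ∉-outside : {Q R : Subset n} {x : Fin n} → x ∈ R → x ∉ Q ∩ ∁ R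
  ∉-outside {Q} {R} x∈R x∈Q∖R = x∈∁p⇒x∉p (proj₂ (x∈p∩q⁻ Q (∁ R) x∈Q∖R)) x∈R

  ⊆-∪-outside : {A D E : Subset n} → A ⊆ D ∪ (E ∩ ∁ A) → A ⊆ D
  ⊆-∪-outside {A} {D} {E} A⊆ x∈A =
    [ (λ x∈D → x∈D) , (λ x∈E∖A → contradiction x∈E∖A (∉-outside x∈A)) ]
      (x∈p∪q⁻ D (E ∩ ∁ A) (A⊆ x∈A))

  ⁅⁆⊆ : {P : Subset n} {x : Fin n} → x ∈ P → ⁅ x ⁆ ⊆ P
  ⁅⁆⊆ {P} {x} x∈P y∈⁅x⁆ = subst (_∈ P) (sym (x∈⁅y⁆⇒x≡y x y∈⁅x⁆)) x∈P

  UpClosed : Family n → Set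
  UpClosed F = {D Y : Subset n} → F D → D ⊆ Y → F Y

  dense⇒upClosed : (F : Family n) → (∀ A → F A → Nonempty A) →
                   (∀ A → Nonempty A → InClosure F A) → UpClosed F
  dense⇒upClosed F nonempty dense {D} {Y} D∈F D⊆Y = fromPoint (nonempty D D∈F)
    where
    fromPoint : Nonempty D → F Y
    fromPoint (d , d∈D) = split (nonempty? W)
      where
      W : Subset n
      W = Y ∩ ∁ ⁅ d ⁆

      D∪W≡Y : D ∪ W ≡ Y
      D∪W≡Y = ∪-refill (⁅⁆⊆ d∈D) D⊆Y

      d∉W : d ∉ W
      d∉W = ∉-outside (x∈⁅x⁆ d)

      -- W ∈ closure(F), so D ∪ W lies in F ∪ {W}; but D ∪ W ≠ W as d ∉ W.
      split : Dec (Nonempty W) → F Y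
      split (yes W-nonempty) = [ subst F D∪W≡Y , D∪W≢W ] (union D W (inj₁ D∈F) (inj₂ refl))
        where
        union : ∀ P Q → insert F W P → insert F W Q → insert F W (P ∪ Q)
        union = proj₂ (proj₂ (proj₂ (dense W W-nonempty)))
        D∪W≢W : D ∪ W ≡ W → F Y
        D∪W≢W D∪W≡W = contradiction (subst (d ∈_) D∪W≡W (x∈p∪q⁺ (inj₁ d∈D))) d∉W
      -- W = ∅ forces Y ⊆ D ∪ ∅ = D.
      split (no W-empty) = subst F (⊆-antisym D⊆Y Y⊆D) D∈F
        where
        Y⊆D : Y ⊆ D
        Y⊆D {x} x∈Y =
          [ (λ x∈D → x∈D) , (λ x∈W → contradiction (x , x∈W) W-empty) ]
            (x∈p∪q⁻ D W (subst (x ∈_) (sym D∪W≡Y) x∈Y))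

  relSub⇒⊆ : {F : Family n} {A B : Subset n} → RelSub F A B → A ⊆ B
  relSub⇒⊆ (inj₁ refl)                      = ⊆-refl
  relSub⇒⊆ (inj₂ (inj₁ refl))               = ⊆⊤
  relSub⇒⊆ (inj₂ (inj₂ (D , _ , _ , refl))) = p⊆p∪q D

  relSub-extend : {F : Family n} → UpClosed F → {A D C : Subset n} →
                  F D → D ≢ A ∪ D → A ∪ D ⊆ C → RelSub F A C
  relSub-extend {F} upClosed {A} {D} {C} D∈F D≢B B⊆C =
    inj₂ (inj₂ (G , upClosed D∈F (p⊆p∪q (C ∩ ∁ A)) , G≢C , A∪G≡C))
    where
    G : Subset n
    G = D ∪ (C ∩ ∁ A)

    A∪G≡C : A ∪ G ≡ C
    A∪G≡C = begin
      A ∪ (D ∪ (C ∩ ∁ A))  ≡⟨ sym (∪-assoc A D (C ∩ ∁ A)) ⟩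
      (A ∪ D) ∪ (C ∩ ∁ A)  ≡⟨ ∪-refill (p⊆p∪q D) B⊆C ⟩
      C                    ∎
      where open ≡-Reasoning

    -- If G = C then A ⊆ C = G forces A ⊆ D, hence D = A ∪ D.
    G≢C : G ≢ C
    G≢C G≡C = D≢B (⊆-antisym (q⊆p∪q A D) (∪-least A⊆D ⊆-refl))
      where
      A⊆D : A ⊆ D
      A⊆D = ⊆-∪-outside (λ x∈A → subst (_ ∈_) (sym G≡C) (B⊆C (p⊆p∪q D x∈A)))

corollary4 : (n : ℕ) (F : Family n) → UnionClosed F → OneDense F →
             (A B C : Subset n) → F A → F B → F C →
             RelSub F A B → RelSub F B C → RelSub F A C
corollary4 n F (nonempty , _ , _) (_ , dense) A B C _ _ _ = transitive
  where
  transitive : RelSub F A B → RelSub F B C → RelSub F A C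
  transitive (inj₁ refl)        B⊑C = B⊑C
  transitive (inj₂ (inj₁ refl)) B⊑C = inj₂ (inj₁ (⊆-antisym ⊆⊤ (relSub⇒⊆ B⊑C)))
  transitive (inj₂ (inj₂ (D , D∈F , D≢B , refl))) B⊑C =
    relSub-extend (dense⇒upClosed F nonempty dense) D∈F D≢B (relSub⇒⊆ B⊑C)
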